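{- Let $m\in\mathbb N$. Consider any labeling scheme (erring only on non-edges) that uses fewer than $m$ distinct labels, and suppose a graph $G$ containing an induced matching on $2m$ vertices is labeled using the scheme. Then the adversary in the single vertex guess model wins against this labeling of $G$ with probability $1$.
   Context: A labeling scheme assigns, via a randomized encoder, labels $\ell(v)$ to the vertices of $G$, and has a deterministic decoder $\mathcal D$; it errs only on non-edges, i.e. $\mathcal D(\ell(u),\ell(v))=1$ for every edge $(u,v)$. Single vertex guess model: the adversary adaptively asks for the labels of vertices $x_1,\dots,x_k\in V(G)$ and then names a vertex $x_{k+1}$ that has not been queried; it wins if $(x_k,x_{k+1})\notin E(G)$ but $\mathcal D(\ell(x_k),\ell(x_{k+1}))=1$. (The adversary may re-query any vertex, so $x_k$ can be any previously queried vertex.) -}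

module Defs where

open import Data.Nat using (ℕ)
open import Data.Fin using (Fin)
open import Data.Bool using (Bool; true)
open import Data.List using (List; []; _∷_; last)
open import Data.List.Membership.Propositional using (_∈_)
open import Data.Maybe using (Maybe; just)
open import Data.Product using (_×_; _,_; ∃)
open import Relation.Nullary using (¬_)
open import Relation.Binary.PropositionalEquality using (_≡_; _≢_)

record Graph (n : ℕ) : Set₁ where
  field
    Adj       : Fin n → Fin n → Set
    symmetric : ∀ {u v} → Adj u v → Adj v u
    irrefl    : ∀ {u} → ¬ Adj u u
open Graph public

record InducedMatching {n : ℕ} (G : Graph n) (m : ℕ) : Set where
  field
    a b      : Fin m → Fin n
    a-inj    : ∀ {i j} → a i ≡ a j → i ≡ j
    b-inj    : ∀ {i j} → b i ≡ b j → i ≡ j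
    a≢b      : ∀ i j → a i ≢ b j
    edge     : ∀ i → Adj G (a i) (b i)
    no-aa    : ∀ i j → i ≢ j → ¬ Adj G (a i) (a j)
    no-ab    : ∀ i j → i ≢ j → ¬ Adj G (a i) (b j)
    no-bb    : ∀ i j → i ≢ j → ¬ Adj G (b i) (b j)

-- A labeling scheme with label alphabet Fin k, applied to G: a randomized
-- encoder (randomness ω ∈ Ω) and a deterministic decoder, erring only on
-- non-edges (for every outcome of the randomness).
record LabelingScheme {n : ℕ} (G : Graph n) (k : ℕ) : Set₁ where
  field
    Ω       : Set
    encode  : Ω → Fin n → Fin k
    decode  : Fin k → Fin k → Bool
    correct : ∀ ω {u v} → Adj G u v → decode (encode ω u) (encode ω v) ≡ true
open LabelingScheme public

-- Deterministic adaptive adversary in the single vertex guess model: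
-- it queries a vertex and continues depending on the returned label,
-- or stops and names the guess vertex x_{k+1}.
data Strategy (n k : ℕ) : Set where
  query : Fin n → (Fin k → Strategy n k) → Strategy n k
  guess : Fin n → Strategy n k

-- Transcript of running a strategy against a labeling:
-- (queried vertices x_1 … x_k in order , guessed vertex x_{k+1}).
run : ∀ {n k} → Strategy n k → (Fin n → Fin k) → List (Fin n) × Fin n
run (guess y)   ℓ = [] , y
run (query v f) ℓ with run (f (ℓ v)) ℓ
... | qs , y = v ∷ qs , y

Wins : ∀ {n k} (G : Graph n) (D : Fin k → Fin k → Bool) (ℓ : Fin n → Fin k)
       → List (Fin n) × Fin n → Set
Wins G D ℓ (qs , y) =
  ∃ λ xk → (last qs ≡ just xk) × ¬ (y ∈ qs) × ¬ Adj G xk y × (D (ℓ xk) (ℓ y) ≡ true)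

-- Query all m vertices a₁, …, aₘ of the matching. With fewer than m labels two of
-- them, aᵢ and aⱼ, share a label; query aᵢ once more and guess bⱼ. The decoder
-- accepts (ℓ aⱼ, ℓ bⱼ) because aⱼbⱼ is an edge, hence also (ℓ aᵢ, ℓ bⱼ), although
-- aᵢbⱼ is a non-edge of the induced matching. This needs no luck: it wins for
-- every outcome of the encoder's randomness.
module Submission where

open import Defs
open import Data.Nat using (ℕ; _<_; zero; suc)
open import Data.Product using (∃; _,_)
open import Data.Fin using (Fin; zero; suc)
open import Data.Fin.Properties using (pigeonhole; <⇒≢)
open import Data.List using (List; []; _∷_; _++_; _∷ʳ_; last; tabulate)
open import Data.List.Membership.Propositional using (_∉_)
open import Data.List.Membership.Propositional.Properties using (∈-++⁻; ∈-tabulate⁻)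
open import Data.List.Relation.Unary.Any using (here)
open import Data.Maybe using (just)
open import Data.Bool using (true)
open import Data.Sum using (inj₁; inj₂)
open import Data.Vec as Vec using (Vec; _∷_; lookup)
open import Data.Vec.Properties using (lookup∘tabulate)
open import Function using (_∘_)
open import Relation.Binary.PropositionalEquality using (_≡_; refl; sym; trans; subst)

last-∷ʳ : ∀ {A : Set} (xs : List A) x → last (xs ∷ʳ x) ≡ just x
last-∷ʳ []           x = refl
last-∷ʳ (_ ∷ [])     x = refl
last-∷ʳ (_ ∷ y ∷ xs) x = last-∷ʳ (y ∷ xs) x

module _ {n k : ℕ} where

  -- The observed labels are collected in a Vec rather than a function Fin m → Fin k,
  -- so that they equal Vec.tabulate (ℓ ∘ a) on the nose (no function extensionality).
  queryAll : ∀ {m} → (Fin m → Fin n) → (Vec (Fin k) m → Strategy n k) → Strategy n k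
  queryAll {zero}  a f = f Vec.[]
  queryAll {suc m} a f = query (a zero) (λ c → queryAll (a ∘ suc) (f ∘ (c ∷_)))

  run-queryAll : ∀ {m} (a : Fin m → Fin n) (f : Vec (Fin k) m → Strategy n k) (ℓ : Fin n → Fin k)
    → let (qs , y) = run (f (Vec.tabulate (ℓ ∘ a))) ℓ
      in run (queryAll a f) ℓ ≡ (tabulate a ++ qs , y)
  run-queryAll {zero}  a f ℓ = refl
  run-queryAll {suc m} a f ℓ rewrite run-queryAll (a ∘ suc) (f ∘ (ℓ (a zero) ∷_)) ℓ = refl

module _ {n k : ℕ} {G : Graph n} (S : LabelingScheme G k) (ω : Ω S) where

  private
    ℓ : Fin n → Fin k
    ℓ = encode S ω

  decode-sameLabel : ∀ {u u′ v} → ℓ u ≡ ℓ u′ → Adj G u′ v → decode S (ℓ u) (ℓ v) ≡ true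
  decode-sameLabel {v = v} ℓu≡ℓu′ u′v =
    subst (λ c → decode S c (ℓ v) ≡ true) (sym ℓu≡ℓu′) (correct S ω u′v)

module _ {n m : ℕ} {G : Graph n} (M : InducedMatching G m) where

  open InducedMatching M

  b∉tabulate-a : ∀ j → b j ∉ tabulate a
  b∉tabulate-a j bj∈ with i , bj≡ai ← ∈-tabulate⁻ bj∈ = a≢b i j (sym bj≡ai)

  b∉tabulate-a∷ʳ : ∀ i j → b j ∉ tabulate a ∷ʳ a i
  b∉tabulate-a∷ʳ i j bj∈ with ∈-++⁻ (tabulate a) bj∈
  ... | inj₁ bj∈as      = b∉tabulate-a j bj∈as
  ... | inj₂ (here bj≡) = a≢b i j (sym bj≡)

claim1p10 : (m k n : ℕ) → k < m → (G : Graph n) → InducedMatching G m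
    → (S : LabelingScheme G k)
    → ∃ λ (A : Strategy n k)
    → ∀ (ω : Ω S) → Wins G (decode S) (encode S ω) (run A (encode S ω))
claim1p10 m k n k<m G M S = queryAll a guessPartner , win
  where
    open InducedMatching M

    guessPartner : Vec (Fin k) m → Strategy n k
    guessPartner labels with i , j , _ ← pigeonhole k<m (lookup labels) =
      query (a i) (λ _ → guess (b j))

    win : ∀ ω → Wins G (decode S) (encode S ω) (run (queryAll a guessPartner) (encode S ω))
    win ω rewrite run-queryAll a guessPartner (encode S ω)
      with pigeonhole k<m (lookup (Vec.tabulate (encode S ω ∘ a)))
    ... | i , j , i<j , same =
      a i , last-∷ʳ (tabulate a) (a i) , b∉tabulate-a∷ʳ M i j , no-ab i j (<⇒≢ i<j) ,
      decode-sameLabel S ω ℓai≡ℓaj (edge j)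
      where
        ℓai≡ℓaj : encode S ω (a i) ≡ encode S ω (a j)
        ℓai≡ℓaj = trans (sym (lookup∘tabulate _ i)) (trans same (lookup∘tabulate _ j))
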